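{- Let $n\ge 1$. The friendship graph $f_n$ admits an $(a,d)$-distance antimagic labeling for some integers $a$ and $d\ge 0$ if and only if $n=1$ or $n=2$.
   Context: The friendship graph $f_n$ is obtained by identifying one vertex from each of $n$ copies of the triangle $K_3$; it has $2n+1$ vertices: a central vertex $x_0$ and vertices $x_{2i-1},x_{2i}$ forming the $i$-th triangle with $x_0$. For a graph $G$ with $v$ vertices and a bijection $f:V(G)\to\{1,\ldots,v\}$, the vertex-weight of $x$ is $w(x)=\sum_{y\in N(x)} f(y)$, $N(x)$ the set of neighbors of $x$. $f$ is an $(a,d)$-distance antimagic labeling, for fixed integers $a$ and $d\ge 0$, if the multiset of vertex-weights is $\{a,a+d,\ldots,a+(v-1)d\}$. -}

module Defs where

open import Data.Nat using (ℕ; zero; suc; _+_; _*_)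
open import Data.Bool using (Bool; true; false; if_then_else_; _∧_; _∨_)
open import Data.Fin using (Fin; toℕ)
open import Data.Nat using (_≡ᵇ_)
open import Data.List using (List; map; filter; allFin)
open import Data.Nat.ListAction using (sum)
open import Data.Integer as ℤ using (ℤ; +_)
open import Data.Product using (Σ; ∃; _×_)
open import Function.Bundles using (_↔_; Inverse)
open import Relation.Binary.PropositionalEquality using (_≡_)

record Graph (v : ℕ) : Set where
  field
    adj : Fin v → Fin v → Bool

open Graph public

-- Friendship graph f_n on 2n+1 vertices x_0, …, x_{2n} (vertex x_k is  k : Fin (2n+1)).
-- x_0 is the centre, adjacent to every other vertex; for i = 1..n,
-- x_{2i-1} and x_{2i} are adjacent.
-- For j,k ≥ 1 (j ≠ k):  x_j ~ x_k  iff  {j,k} = {2i-1, 2i}  iff  ⌈j/2⌉ = ⌈k/2⌉.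
-- With j = 1+j', k = 1+k': iff  j' div 2 = k' div 2.
friendAdjℕ : ℕ → ℕ → Bool
friendAdjℕ zero zero = false
friendAdjℕ zero (suc _) = true
friendAdjℕ (suc _) zero = true
friendAdjℕ (suc j) (suc k) = Data.Bool.not (j ≡ᵇ k) ∧ (Data.Nat._/_ j 2 ≡ᵇ Data.Nat._/_ k 2)

friendship : (n : ℕ) → Graph (2 * n + 1)
friendship n = record { adj = λ x y → friendAdjℕ (toℕ x) (toℕ y) }

weight : ∀ {v} → Graph v → (Fin v → ℕ) → Fin v → ℕ
weight {v} G f x = sum (map f (filter (λ y → Data.Bool._≟_ (adj G x y) true) (allFin v)))

-- f : V(G) → {1,…,v} is a bijection: f = 1 + toℕ ∘ σ for a permutation σ of Fin v.
-- f is (a,d)-distance antimagic iff the multiset of weights is {a, a+d, …, a+(v-1)d},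
-- i.e. there is a bijection τ : V(G) → Fin v with w(x) = a + d·τ(x).
IsDistanceAntimagic : ∀ {v} → Graph v → (Fin v → ℕ) → ℤ → ℕ → Set
IsDistanceAntimagic {v} G f a d =
  (Σ (Fin v ↔ Fin v) λ σ → ∀ x → f x ≡ suc (toℕ (Inverse.to σ x))) ×
  (Σ (Fin v ↔ Fin v) λ τ → ∀ x → + (weight G f x) ≡ a ℤ.+ (+ d) ℤ.* (+ toℕ (Inverse.to τ x)))

HasDistanceAntimagic : ∀ {v} → Graph v → Set
HasDistanceAntimagic {v} G = Σ (Fin v → ℕ) λ f → Σ ℤ λ a → Σ ℕ λ d → IsDistanceAntimagic G f a d

-- The centre x_0 is adjacent to every other vertex, so w(x_0) = S − f(x_0) with
-- S = (2n+1)(2n+2)/2, while a leaf x sees only the centre and its mate: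
-- w(x) = f(x_0) + f(mate x). Hence the leaf weights are exactly f(x_0) + ℓ for
-- the labels ℓ ≠ f(x_0). Two consecutive such labels force d = 1, so the weights
-- are a, a+1, …, a+2n with a ≤ f(x_0) + 2, giving w(x_0) ≤ f(x_0) + 2 + 2n.
-- Then S = f(x_0) + w(x_0) ≤ 6n + 4, false for n ≥ 3. For n = 1, 2 explicit
-- labellings are checked by evaluation.
module Submission where

open import Defs
open import Data.Bool using (true)
import Data.Bool as Bool
open import Data.Fin using (Fin; zero; suc; toℕ; fromℕ<; #_)
import Data.Fin as Fin
open import Data.Fin.Properties
  using (toℕ-fromℕ<; toℕ<n; toℕ-injective; toℕ-inject₁; toℕ-fromℕ; all?)
import Data.Fin.Properties as Finₚ
open import Data.Integer as ℤ using (ℤ)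
import Data.Integer.Properties as ℤ
open import Data.List using ([]; _∷_; map; filter; tabulate; allFin)
open import Data.List.Properties using (map-tabulate; filter-accept; filter-reject; filter-all; filter-none)
open import Data.List.Relation.Unary.All.Properties using (tabulate⁺)
open import Data.Nat using (ℕ; zero; suc; _+_; _*_; _≤_; _<_; _≥_; z≤n; s≤s; z<s; _/_; _≟_)
open import Data.Nat.DivMod using (m/n≡1+[m∸n]/n)
open import Data.Nat.Divisibility using (_∣_; ∣m+n∣m⇒∣n; m∣m*n; ∣1⇒≡1)
open import Data.Nat.ListAction using (sum)
open import Data.Nat.Properties
open import Data.Nat.Solver using (module +-*-Solver)
open import Data.Product using (Σ; ∃-syntax; _,_)
open import Data.Sum using (_⊎_; inj₁; inj₂)
open import Data.Vec using (_∷_; []; lookup)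
open import Algebra.Properties.CommutativeMonoid.Sum +-0-commutativeMonoid
  using (sum-cong-≗; sum-init-last; sum-permute) renaming (sum to ∑)
open import Function using (_∘_; id)
open import Function.Bundles using (_↔_; _⇔_; Inverse; mk⇔; mk↔ₛ′)
open import Function.Construct.Identity using (↔-id)
open import Relation.Nullary using (¬_; yes; no; contradiction)
open import Relation.Nullary.Decidable using (True; toWitness)
open import Relation.Unary using (Pred; Decidable)
open import Relation.Binary.PropositionalEquality

open +-*-Solver

module _ {a p} {A : Set a} {P : Pred A p} (P? : Decidable P) where

  filter-tabulate-unique : ∀ {m} (g : Fin m → A) (i : Fin m) →
    P (g i) → (∀ j → P (g j) → j ≡ i) → filter P? (tabulate g) ≡ g i ∷ []
  filter-tabulate-unique g zero Pgi unique =
    trans (filter-accept P? Pgi)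
          (cong (g zero ∷_) (filter-none P? (tabulate⁺ λ j Pgj → Finₚ.0≢1+n (sym (unique (suc j) Pgj)))))
  filter-tabulate-unique g (suc i) Pgi unique =
    trans (filter-reject P? λ Pg0 → Finₚ.0≢1+n (unique zero Pg0))
          (filter-tabulate-unique (g ∘ suc) i Pgi λ j Pgj → Finₚ.suc-injective (unique (suc j) Pgj))

sum-tabulate : ∀ {m} (h : Fin m → ℕ) → sum (tabulate h) ≡ ∑ h
sum-tabulate {zero}  h = refl
sum-tabulate {suc m} h = cong (h zero +_) (sum-tabulate (h ∘ suc))

double-∑-suc-toℕ : ∀ m → 2 * ∑ {m} (suc ∘ toℕ) ≡ m * suc m
double-∑-suc-toℕ zero    = refl
double-∑-suc-toℕ (suc m) = begin
  2 * ∑ {suc m} (suc ∘ toℕ)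
    ≡⟨ cong (2 *_) (sum-init-last {m} (suc ∘ toℕ)) ⟩
  2 * (∑ {m} (suc ∘ toℕ ∘ Fin.inject₁) + suc (toℕ (Fin.fromℕ m)))
    ≡⟨ cong₂ (λ s t → 2 * (s + suc t)) (sum-cong-≗ {m} (cong suc ∘ toℕ-inject₁)) (toℕ-fromℕ m) ⟩
  2 * (∑ {m} (suc ∘ toℕ) + suc m)
    ≡⟨ *-distribˡ-+ 2 (∑ {m} (suc ∘ toℕ)) (suc m) ⟩
  2 * ∑ {m} (suc ∘ toℕ) + 2 * suc m
    ≡⟨ cong (_+ 2 * suc m) (double-∑-suc-toℕ m) ⟩
  m * suc m + 2 * suc m
    ≡⟨ solve 1 (λ m → m :* (con 1 :+ m) :+ con 2 :* (con 1 :+ m) := (con 1 :+ m) :* (con 2 :+ m)) refl m ⟩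
  suc m * suc (suc m)
    ∎
  where open ≡-Reasoning

IsBijectiveLabelling : ∀ {v} → (Fin v → ℕ) → Set
IsBijectiveLabelling {v} f = Σ (Fin v ↔ Fin v) λ σ → ∀ x → f x ≡ suc (toℕ (Inverse.to σ x))

double-labelSum : ∀ {v} {f : Fin v → ℕ} → IsBijectiveLabelling f →
                  2 * sum (map f (allFin v)) ≡ v * suc v
double-labelSum {v} {f} (σ , f≡) = begin
  2 * sum (map f (allFin v))           ≡⟨ cong (λ l → 2 * sum l) (map-tabulate id f) ⟩
  2 * sum (tabulate f)                 ≡⟨ cong (2 *_) (sum-tabulate f) ⟩
  2 * ∑ f                              ≡⟨ cong (2 *_) (sum-cong-≗ {v} f≡) ⟩
  2 * ∑ (suc ∘ toℕ ∘ Inverse.to σ)     ≡⟨ cong (2 *_) (sum-permute {v} {v} (suc ∘ toℕ) σ) ⟨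
  2 * ∑ {v} (suc ∘ toℕ)                ≡⟨ double-∑-suc-toℕ v ⟩
  v * suc v                            ∎
  where open ≡-Reasoning

label-attained : ∀ {v} {f : Fin v → ℕ} → IsBijectiveLabelling f →
                 ∀ {ℓ} → ℓ < v → ∃[ u ] f u ≡ suc ℓ
label-attained (σ , f≡) ℓ<v =
  Inverse.from σ (fromℕ< ℓ<v) ,
  trans (f≡ _) (cong suc (trans (cong toℕ (Inverse.strictlyInverseˡ σ _)) (toℕ-fromℕ< ℓ<v)))

progression-balance : ∀ (a : ℤ) d {p q s t} →
  ℤ.+ p ≡ a ℤ.+ ℤ.+ d ℤ.* ℤ.+ s → ℤ.+ q ≡ a ℤ.+ ℤ.+ d ℤ.* ℤ.+ t → p + d * t ≡ q + d * s
progression-balance a d {p} {q} {s} {t} p≡ q≡ = ℤ.+-injective (begin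
  ℤ.+ (p + d * t)                             ≡⟨ shifted p≡ ⟩
  a ℤ.+ (ℤ.+ d ℤ.* ℤ.+ s ℤ.+ ℤ.+ d ℤ.* ℤ.+ t) ≡⟨ cong (ℤ._+_ a) (ℤ.+-comm (ℤ.+ d ℤ.* ℤ.+ s) _) ⟩
  a ℤ.+ (ℤ.+ d ℤ.* ℤ.+ t ℤ.+ ℤ.+ d ℤ.* ℤ.+ s) ≡⟨ shifted q≡ ⟨
  ℤ.+ (q + d * s)                             ∎)
  where
  open ≡-Reasoning
  shifted : ∀ {r x k} → ℤ.+ r ≡ a ℤ.+ x → ℤ.+ (r + d * k) ≡ a ℤ.+ (x ℤ.+ ℤ.+ d ℤ.* ℤ.+ k)
  shifted {r} {x} {k} r≡ = begin
    ℤ.+ (r + d * k)                 ≡⟨ ℤ.pos-+ r (d * k) ⟩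
    ℤ.+ r ℤ.+ ℤ.+ (d * k)           ≡⟨ cong₂ ℤ._+_ r≡ (ℤ.pos-* d k) ⟩
    a ℤ.+ x ℤ.+ ℤ.+ d ℤ.* ℤ.+ k     ≡⟨ ℤ.+-assoc a x _ ⟩
    a ℤ.+ (x ℤ.+ ℤ.+ d ℤ.* ℤ.+ k)   ∎

d*y≡1+d*x⇒d≡1 : ∀ d {x y} → d * y ≡ suc (d * x) → d ≡ 1
d*y≡1+d*x⇒d≡1 d {x} {y} e =
  ∣1⇒≡1 (∣m+n∣m⇒∣n (subst (d ∣_) (trans e (+-comm 1 (d * x))) (m∣m*n y)) (m∣m*n x))

2[c+w]<[1+m][2+m] : ∀ {m c w} → 6 ≤ m → c ≤ suc m → w ≤ c + 2 + m →
                    2 * (c + w) < suc m * suc (suc m)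
2[c+w]<[1+m][2+m] {m} {c} {w} (s≤s (s≤s (s≤s (s≤s (s≤s (s≤s {n = r} z≤n)))))) c≤ w≤ = begin-strict
  2 * (c + w)
    ≤⟨ *-monoʳ-≤ 2 (+-mono-≤ c≤ (≤-trans w≤ (+-monoˡ-≤ m (+-monoˡ-≤ 2 c≤)))) ⟩
  2 * (suc m + (suc m + 2 + m))
    <⟨ m<m+n _ z<s ⟩
  2 * (suc m + (suc m + 2 + m)) + suc (11 + 9 * r + r * r)
    ≡⟨ solve 1 (λ r → con 2 :* ((con 7 :+ r) :+ ((con 7 :+ r) :+ con 2 :+ (con 6 :+ r)))
                        :+ (con 1 :+ (con 11 :+ con 9 :* r :+ r :* r))
                      := (con 7 :+ r) :* (con 8 :+ r)) refl r ⟩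
  suc m * suc (suc m)
    ∎
  where open ≤-Reasoning

-- Leaf x_{1+j} lies in the triangle of leaf x_{1+mate j}.
mate : ℕ → ℕ
mate zero                = 1
mate (suc zero)          = 0
mate (suc (suc j))       = suc (suc (mate j))

mate-involutive : ∀ j → mate (mate j) ≡ j
mate-involutive zero          = refl
mate-involutive (suc zero)    = refl
mate-involutive (suc (suc j)) = cong (2 +_) (mate-involutive j)

mate-< : ∀ n {j} → j < n + n → mate j < n + n
mate-< (suc n) {zero}        _   rewrite +-suc n n = s≤s (s≤s z≤n)
mate-< (suc n) {suc zero}    _   = s≤s z≤n
mate-< (suc n) {suc (suc j)} j< rewrite +-suc n n = s≤s (s≤s (mate-< n (≤-pred (≤-pred j<))))

[2+j]/2≡1+j/2 : ∀ j → suc (suc j) / 2 ≡ suc (j / 2)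
[2+j]/2≡1+j/2 j = m/n≡1+[m∸n]/n {suc (suc j)} {2} (s≤s (s≤s z≤n))

friendAdj-mate : ∀ j → friendAdjℕ (suc j) (suc (mate j)) ≡ true
friendAdj-mate zero          = refl
friendAdj-mate (suc zero)    = refl
friendAdj-mate (suc (suc j)) rewrite [2+j]/2≡1+j/2 j | [2+j]/2≡1+j/2 (mate j) = friendAdj-mate j

friendAdj⇒mate : ∀ j k → friendAdjℕ (suc j) (suc k) ≡ true → k ≡ mate j
friendAdj⇒mate zero          (suc zero)    _ = refl
friendAdj⇒mate (suc zero)    zero          _ = refl
friendAdj⇒mate (suc (suc j)) (suc (suc k)) adj
  rewrite [2+j]/2≡1+j/2 j | [2+j]/2≡1+j/2 k = cong (2 +_) (friendAdj⇒mate j k adj)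
friendAdj⇒mate zero          (suc (suc k)) adj rewrite [2+j]/2≡1+j/2 k = contradiction adj λ ()
friendAdj⇒mate (suc zero)    (suc (suc k)) adj rewrite [2+j]/2≡1+j/2 k = contradiction adj λ ()
friendAdj⇒mate (suc (suc j)) zero          adj rewrite [2+j]/2≡1+j/2 j = contradiction adj λ ()
friendAdj⇒mate (suc (suc j)) (suc zero)    adj rewrite [2+j]/2≡1+j/2 j = contradiction adj λ ()

mateFin : ∀ n → Fin (n + n) → Fin (n + n)
mateFin n x = fromℕ< (mate-< n (toℕ<n x))

toℕ-mateFin : ∀ n (x : Fin (n + n)) → toℕ (mateFin n x) ≡ mate (toℕ x)
toℕ-mateFin n x = toℕ-fromℕ< _

mateFin-involutive : ∀ n (x : Fin (n + n)) → mateFin n (mateFin n x) ≡ x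
mateFin-involutive n x = toℕ-injective (begin
  toℕ (mateFin n (mateFin n x)) ≡⟨ toℕ-mateFin n (mateFin n x) ⟩
  mate (toℕ (mateFin n x))      ≡⟨ cong mate (toℕ-mateFin n x) ⟩
  mate (mate (toℕ x))           ≡⟨ mate-involutive (toℕ x) ⟩
  toℕ x                         ∎)
  where open ≡-Reasoning

-- friendship n is friendshipOn (2 * n + 1) definitionally; writing the vertex
-- count as suc m makes the centre Fin.zero and the leaves Fin.suc.
friendshipOn : ∀ v → Graph v
friendshipOn v = record { adj = λ x y → friendAdjℕ (toℕ x) (toℕ y) }

weight-centre : ∀ m (f : Fin (suc m) → ℕ) →
                f zero + weight (friendshipOn (suc m)) f zero ≡ sum (map f (allFin (suc m)))
weight-centre m f = cong (λ l → f zero + sum (map f l))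
  (filter-all (λ y → friendAdjℕ 0 (toℕ y) Bool.≟ true) {tabulate {n = m} suc} (tabulate⁺ λ _ → refl))

weight-leaf : ∀ n (f : Fin (suc (n + n)) → ℕ) (x : Fin (n + n)) →
              weight (friendshipOn (suc (n + n))) f (suc x) ≡ f zero + f (suc (mateFin n x))
weight-leaf n f x = begin
  f zero + sum (map f (filter adjacent? (tabulate suc))) ≡⟨ cong (λ l → f zero + sum (map f l)) only-mate ⟩
  f zero + (f (suc (mateFin n x)) + 0)                   ≡⟨ cong (f zero +_) (+-identityʳ _) ⟩
  f zero + f (suc (mateFin n x))                         ∎
  where
  open ≡-Reasoning
  adjacent? : Decidable λ (y : Fin (suc (n + n))) → friendAdjℕ (suc (toℕ x)) (toℕ y) ≡ true
  adjacent? y = friendAdjℕ (suc (toℕ x)) (toℕ y) Bool.≟ true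
  only-mate : filter adjacent? (tabulate suc) ≡ suc (mateFin n x) ∷ []
  only-mate = filter-tabulate-unique adjacent? suc (mateFin n x)
    (subst (λ k → friendAdjℕ (suc (toℕ x)) (suc k) ≡ true) (sym (toℕ-mateFin n x)) (friendAdj-mate (toℕ x)))
    (λ j adj → toℕ-injective (trans (friendAdj⇒mate (toℕ x) (toℕ j) adj) (sym (toℕ-mateFin n x))))

module DistanceAntimagicFriendship
  {n : ℕ} {f : Fin (suc (n + n)) → ℕ} {a : ℤ} {d : ℕ}
  (bijective : IsBijectiveLabelling f)
  (τ : Fin (suc (n + n)) ↔ Fin (suc (n + n)))
  (weight≡ : ∀ x → ℤ.+ weight (friendshipOn (suc (n + n))) f x ≡ a ℤ.+ ℤ.+ d ℤ.* ℤ.+ toℕ (Inverse.to τ x))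
  where

  W : Fin (suc (n + n)) → ℕ
  W = weight (friendshipOn (suc (n + n))) f

  c : ℕ
  c = f zero

  rank : Fin (suc (n + n)) → ℕ
  rank x = toℕ (Inverse.to τ x)

  balance : ∀ x y → W x + d * rank y ≡ W y + d * rank x
  balance x y = progression-balance a d (weight≡ x) (weight≡ y)

  leafWeight-attained : ∀ {ℓ} → ℓ < suc (n + n) → suc ℓ ≢ c → ∃[ u ] W u ≡ c + suc ℓ
  leafWeight-attained {ℓ} ℓ< ℓ≢c with label-attained bijective ℓ<
  ... | zero  , fu = contradiction (sym fu) ℓ≢c
  ... | suc x , fu = suc (mateFin n x) , (begin
    W (suc (mateFin n x))                 ≡⟨ weight-leaf n f (mateFin n x) ⟩
    c + f (suc (mateFin n (mateFin n x))) ≡⟨ cong (λ y → c + f (suc y)) (mateFin-involutive n x) ⟩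
    c + f (suc x)                         ≡⟨ cong (c +_) fu ⟩
    c + suc ℓ                             ∎)
    where open ≡-Reasoning

  consecutiveLabels⇒d≡1 : ∀ ℓ → suc (suc ℓ) < suc (n + n) → suc ℓ ≢ c → suc (suc ℓ) ≢ c → d ≡ 1
  consecutiveLabels⇒d≡1 ℓ ℓ< ℓ≢c 1+ℓ≢c
    with (x , Wx) ← leafWeight-attained (<-trans (n<1+n ℓ) (<-trans (n<1+n (suc ℓ)) ℓ<)) ℓ≢c
       | (y , Wy) ← leafWeight-attained (<-trans (n<1+n (suc ℓ)) ℓ<) 1+ℓ≢c
    = d*y≡1+d*x⇒d≡1 d (+-cancelˡ-≡ (W x) _ _ (begin
    W x + d * rank y             ≡⟨ balance x y ⟩
    W y + d * rank x             ≡⟨ cong (_+ d * rank x) (trans Wy (+-suc c (suc ℓ))) ⟩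
    suc (c + suc ℓ) + d * rank x ≡⟨ cong (λ w → suc w + d * rank x) Wx ⟨
    suc (W x) + d * rank x       ≡⟨ +-suc (W x) (d * rank x) ⟨
    W x + suc (d * rank x)       ∎))
    where open ≡-Reasoning

  -- Among the labels 1, 2 or among 3, 4 neither equals c.
  d≡1 : 4 ≤ n + n → d ≡ 1
  d≡1 4≤2n with 3 ≤? c
  ... | yes 3≤c = consecutiveLabels⇒d≡1 0 (s≤s (≤-trans (s≤s (s≤s z≤n)) 4≤2n))
                    (<⇒≢ (≤-trans (s≤s (s≤s z≤n)) 3≤c)) (<⇒≢ 3≤c)
  ... | no 3≰c  = consecutiveLabels⇒d≡1 2 (s≤s 4≤2n)
                    (≢-sym (<⇒≢ (≰⇒> 3≰c))) (≢-sym (<⇒≢ (m<n⇒m<1+n (≰⇒> 3≰c))))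

  weightCentre≤-fromLabel : 1 ≤ n + n → d ≡ 1 → ∀ ℓ → ℓ ≤ 1 → suc ℓ ≢ c → W zero ≤ c + 2 + (n + n)
  weightCentre≤-fromLabel 1≤2n refl ℓ ℓ≤1 ℓ≢c
    with (u , Wu) ← leafWeight-attained (s≤s (≤-trans ℓ≤1 1≤2n)) ℓ≢c
    = begin
    W zero          ≤⟨ m≤m+n (W zero) (rank u) ⟩
    W zero + rank u ≡⟨ subst₂ (λ r s → W zero + r ≡ W u + s) (*-identityˡ _) (*-identityˡ _) (balance zero u) ⟩
    W u + rank zero ≤⟨ +-mono-≤ Wu≤ (≤-pred (toℕ<n (Inverse.to τ zero))) ⟩
    c + 2 + (n + n) ∎
    where
    open ≤-Reasoning
    Wu≤ : W u ≤ c + 2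
    Wu≤ = ≤-trans (≤-reflexive Wu) (+-monoʳ-≤ c (s≤s ℓ≤1))

  weightCentre≤ : 1 ≤ n + n → d ≡ 1 → W zero ≤ c + 2 + (n + n)
  weightCentre≤ 1≤2n d≡1 with c ≟ 1
  ... | yes c≡1 = weightCentre≤-fromLabel 1≤2n d≡1 1 ≤-refl λ 2≡c → contradiction (trans 2≡c c≡1) λ ()
  ... | no c≢1  = weightCentre≤-fromLabel 1≤2n d≡1 0 z≤n (c≢1 ∘ sym)

  double-centreMass : 2 * (c + W zero) ≡ suc (n + n) * suc (suc (n + n))
  double-centreMass = trans (cong (2 *_) (weight-centre (n + n) f)) (double-labelSum bijective)

¬hasDistanceAntimagic-friendshipOn : ∀ n → 3 ≤ n → ¬ HasDistanceAntimagic (friendshipOn (suc (n + n)))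
¬hasDistanceAntimagic-friendshipOn n 3≤n (f , a , d , bijective@(σ , f≡) , τ , weight≡) =
  <⇒≱ (2[c+w]<[1+m][2+m] 6≤2n c≤1+m W₀≤) (≤-reflexive (sym double-centreMass))
  where
  open DistanceAntimagicFriendship {n} {f} {a} {d} bijective τ weight≡
  6≤2n : 6 ≤ n + n
  6≤2n = +-mono-≤ 3≤n 3≤n
  W₀≤ : W zero ≤ c + 2 + (n + n)
  W₀≤ = weightCentre≤ (≤-trans (s≤s z≤n) 6≤2n) (d≡1 (≤-trans (m≤m+n 4 2) 6≤2n))
  c≤1+m : c ≤ suc (n + n)
  c≤1+m = ≤-trans (≤-reflexive (f≡ zero)) (toℕ<n (Inverse.to σ zero))

¬hasDistanceAntimagic-friendship : ∀ n → 3 ≤ n → ¬ HasDistanceAntimagic (friendship n)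
¬hasDistanceAntimagic-friendship n 3≤n =
  ¬hasDistanceAntimagic-friendshipOn n 3≤n ∘ subst (λ v → HasDistanceAntimagic (friendshipOn v)) 2n+1≡1+n+n
  where
  2n+1≡1+n+n : 2 * n + 1 ≡ suc (n + n)
  2n+1≡1+n+n = solve 1 (λ n → con 2 :* n :+ con 1 := con 1 :+ (n :+ n)) refl n

permutation : ∀ {v} (π π⁻¹ : Fin v → Fin v) →
  True (all? λ x → π (π⁻¹ x) Fin.≟ x) → True (all? λ x → π⁻¹ (π x) Fin.≟ x) → Fin v ↔ Fin v
permutation π π⁻¹ ππ⁻¹ π⁻¹π = mk↔ₛ′ π π⁻¹ (toWitness ππ⁻¹) (toWitness π⁻¹π)

hasDistanceAntimagic-byEvaluation : ∀ {v} (G : Graph v) (σ τ : Fin v ↔ Fin v) (a : ℤ) (d : ℕ) →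
  True (all? λ x → ℤ.+ weight G (suc ∘ toℕ ∘ Inverse.to σ) x ℤ.≟ a ℤ.+ ℤ.+ d ℤ.* ℤ.+ toℕ (Inverse.to τ x)) →
  HasDistanceAntimagic G
hasDistanceAntimagic-byEvaluation G σ τ a d weights =
  suc ∘ toℕ ∘ Inverse.to σ , a , d , (σ , λ _ → refl) , τ , toWitness weights

-- Labels (1, 2, 3) on (x₀, x₁, x₂) give weights (5, 4, 3).
hasDistanceAntimagic-friendship₁ : HasDistanceAntimagic (friendship 1)
hasDistanceAntimagic-friendship₁ =
  hasDistanceAntimagic-byEvaluation (friendship 1) (↔-id _) (permutation reverse reverse _ _) (ℤ.+ 3) 1 _
  where
  reverse : Fin 3 → Fin 3
  reverse = lookup (# 2 ∷ # 1 ∷ # 0 ∷ [])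

-- Labels (5, 1, 2, 3, 4) on (x₀, …, x₄) give weights (10, 7, 6, 9, 8).
hasDistanceAntimagic-friendship₂ : HasDistanceAntimagic (friendship 2)
hasDistanceAntimagic-friendship₂ =
  hasDistanceAntimagic-byEvaluation (friendship 2)
    (permutation (lookup (# 4 ∷ # 0 ∷ # 1 ∷ # 2 ∷ # 3 ∷ [])) (lookup (# 1 ∷ # 2 ∷ # 3 ∷ # 4 ∷ # 0 ∷ [])) _ _)
    (permutation (lookup (# 4 ∷ # 1 ∷ # 0 ∷ # 3 ∷ # 2 ∷ [])) (lookup (# 2 ∷ # 1 ∷ # 4 ∷ # 3 ∷ # 0 ∷ [])) _ _)
    (ℤ.+ 6) 1 _

mainTheorem14 : (n : ℕ) → n ≥ 1 →
    (HasDistanceAntimagic (friendship n) ⇔ (n ≡ 1 ⊎ n ≡ 2))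
mainTheorem14 n n≥1 = mk⇔ (onlyIf n n≥1) if
  where
  onlyIf : ∀ n → n ≥ 1 → HasDistanceAntimagic (friendship n) → n ≡ 1 ⊎ n ≡ 2
  onlyIf 1 _ _ = inj₁ refl
  onlyIf 2 _ _ = inj₂ refl
  onlyIf n@(suc (suc (suc _))) _ antimagic =
    contradiction antimagic (¬hasDistanceAntimagic-friendship n (s≤s (s≤s (s≤s z≤n))))
  if : n ≡ 1 ⊎ n ≡ 2 → HasDistanceAntimagic (friendship n)
  if (inj₁ refl) = hasDistanceAntimagic-friendship₁
  if (inj₂ refl) = hasDistanceAntimagic-friendship₂
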